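{- For every integer $n \geq 36$, there is a regular $K_4$-saturated graph on $n$ vertices.
   Context: All graphs are finite and simple. A graph $G$ is $K_4$-saturated if $G$ contains no subgraph isomorphic to $K_4$ (the complete graph on 4 vertices), but adding any edge between two nonadjacent vertices creates a $K_4$. A graph is regular if all its vertices have the same degree. -}

module Defs where

open import Data.Nat using (ℕ)
open import Data.Bool using (Bool; true; false; T)
open import Data.Fin using (Fin)
open import Data.List using (List; filter; length; allFin)
open import Data.Sum using (_⊎_)
open import Data.Product using (Σ; _×_; ∃; ∃-syntax)
open import Relation.Nullary using (¬_)
open import Relation.Binary.PropositionalEquality using (_≡_; _≢_)
open import Data.Bool.Properties using (T?)

record Graph (n : ℕ) : Set where
  field
    adj     : Fin n → Fin n → Bool
    sym     : ∀ u v → adj u v ≡ adj v u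
    irrefl  : ∀ v → adj v v ≡ false

open Graph public

Adj : ∀ {n} → Graph n → Fin n → Fin n → Set
Adj G u v = T (adj G u v)

degree : ∀ {n} → Graph n → Fin n → ℕ
degree {n} G v = length (filter (λ u → T? (adj G v u)) (allFin n))

Regular : ∀ {n} → Graph n → Set
Regular {n} G = ∃[ d ] (∀ (v : Fin n) → degree G v ≡ d)

ContainsK4 : ∀ {n} → (Fin n → Fin n → Set) → Set
ContainsK4 {n} R = Σ (Fin n) λ a → Σ (Fin n) λ b → Σ (Fin n) λ c → Σ (Fin n) λ d →
  (a ≢ b × a ≢ c × a ≢ d × b ≢ c × b ≢ d × c ≢ d) ×
  (R a b × R a c × R a d × R b c × R b d × R c d)

AdjPlus : ∀ {n} → Graph n → Fin n → Fin n → Fin n → Fin n → Set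
AdjPlus G u v x y = Adj G x y ⊎ ((x ≡ u × y ≡ v) ⊎ (x ≡ v × y ≡ u))

K4Saturated : ∀ {n} → Graph n → Set
K4Saturated {n} G =
  ¬ ContainsK4 (Adj G) ×
  (∀ (u v : Fin n) → u ≢ v → ¬ Adj G u v → ContainsK4 (AdjPlus G u v))

-- The graph is the circulant graph on ℤ_n with connection set
-- A = [a, 3a) ∪ (n − 3a, n − a], where 8a ≤ n + 2 and n + 3 ≤ 10a; such an a
-- exists once n ≥ 36. It is regular, and since rotations are automorphisms,
-- K4-freeness and saturation need only be checked at the vertex 0. No three
-- elements of A have pairwise differences in A: two of them would lie in the
-- same interval of A, of length 2a, which has no room for two gaps ≥ a. Every
-- t ∉ A is completed to a K4 by two adjacent common neighbours x, y of 0 and t,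
-- found by locating t between the intervals (e.g. x = a, y = 2a for 3a ≤ t < 4a);
-- the reflection t ↦ n − t preserves A and halves the number of cases.

module Submission where

open import Defs
open import Data.Nat using (ℕ; _≥_)
open import Data.Product using (Σ; _×_)

open import Data.Nat using (zero; suc; _+_; _*_; _∸_; _≤_; _<_; z≤n; s≤s; ∣_-_∣; _≤?_; _<?_)
open import Data.Nat.Properties
open import Data.Nat.DivMod using (_/_; _%_; m≡m%n+[m/n]*n; m%n<n)
open import Data.Nat.Tactic.RingSolver using (solve)
open import Data.Bool using (Bool; true; false; T)
open import Data.Empty using (⊥; ⊥-elim)
open import Data.Fin using (Fin; toℕ; fromℕ<)
open import Data.Fin.Properties using (toℕ<n; toℕ-fromℕ<; toℕ-injective)
open import Data.Fin.Permutation using (Permutation; permutation)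
open import Data.List.Base using ([]; _∷_; length; filter; tabulate)
open import Data.Bool.Properties using (T?)
open import Data.Product using (_,_; ∃; ∃₂)
open import Data.Sum using (_⊎_; inj₁; inj₂)
open import Function.Base using (_∘_)
open import Function.Bundles using (_⇔_; mk⇔; Equivalence)
open import Relation.Binary.PropositionalEquality renaming (sym to ≡-sym)
open import Relation.Nullary using (¬_; Dec; yes; no; does)
open import Relation.Nullary.Decidable using (dec-false; does-⇔; _×-dec_; _⊎-dec_)
open import Relation.Unary using (Decidable)
open import Algebra.Properties.CommutativeMonoid.Sum +-0-commutativeMonoid using (sum; sum-permute; sum-cong-≗)

-- Linear arithmetic: add up hypotheses with ⊕, then let the ring solver
-- identify the two sides of the resulting inequality.
infixl 6 _⊕_
_⊕_ : ∀ {a b c d} → a ≤ b → c ≤ d → a + c ≤ b + d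
_⊕_ = +-mono-≤

≤-by-sum : ∀ {L R P Q} → L ≤ R → (k : ℕ) → P + R + k ≡ Q + L → P ≤ Q
≤-by-sum {L} {R} {P} {Q} L≤R k eq =
  +-cancelʳ-≤ R P Q (≤-trans (m≤m+n (P + R) k) (≤-trans (≤-reflexive eq) (+-monoʳ-≤ Q L≤R)))

absurd-by-sum : ∀ {L R} → L ≤ R → (k : ℕ) → L ≡ suc (R + k) → ⊥
absurd-by-sum {L} {R} L≤R k eq = <-irrefl refl (≤-trans (s≤s (m≤m+n R k)) (subst (_≤ R) eq L≤R))

≤⇒∃ : ∀ {m n} → m ≤ n → ∃ λ k → m + k ≡ n
≤⇒∃ {m} {n} m≤n = n ∸ m , m+[n∸m]≡n m≤n

m+n≡o⇒o∸m≡n : ∀ {m n o} → m + n ≡ o → o ∸ m ≡ n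
m+n≡o⇒o∸m≡n {m} {n} refl = m+n∸m≡n m n

m+n≡o⇒∣m-o∣≡n : ∀ {m n o} → m + n ≡ o → ∣ m - o ∣ ≡ n
m+n≡o⇒∣m-o∣≡n {m} {n} refl = ∣m-m+n∣≡n m n

m+n≡o⇒∣o-m∣≡n : ∀ {m n o} → m + n ≡ o → ∣ o - m ∣ ≡ n
m+n≡o⇒∣o-m∣≡n {m} {n} {o} eq = trans (∣-∣-comm o m) (m+n≡o⇒∣m-o∣≡n eq)

∣-∣-complement-≤ : ∀ {n x′ y′} x y → x ≤ y → x + x′ ≡ n → y + y′ ≡ n → ∣ x′ - y′ ∣ ≡ ∣ x - y ∣
∣-∣-complement-≤ {n} {x′} {y′} x y x≤y ex ey with ≤⇒∃ x≤y
... | d , x+d≡y = trans (m+n≡o⇒∣o-m∣≡n y′+d≡x′) (≡-sym (m+n≡o⇒∣m-o∣≡n x+d≡y))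
  where
  y′+d≡x′ : y′ + d ≡ x′
  y′+d≡x′ = +-cancelˡ-≡ x (y′ + d) x′ (begin
    x + (y′ + d)  ≡⟨ solve (x ∷ y′ ∷ d ∷ []) ⟩
    y′ + (x + d)  ≡⟨ cong (y′ +_) x+d≡y ⟩
    y′ + y        ≡⟨ trans (+-comm y′ y) (trans ey (≡-sym ex)) ⟩
    x + x′        ∎)
    where open ≡-Reasoning

∣-∣-complement : ∀ {n x′ y′} x y → x + x′ ≡ n → y + y′ ≡ n → ∣ x′ - y′ ∣ ≡ ∣ x - y ∣
∣-∣-complement {n} {x′} {y′} x y ex ey with ≤-total x y
... | inj₁ x≤y = ∣-∣-complement-≤ x y x≤y ex ey
... | inj₂ y≤x = trans (∣-∣-comm x′ y′) (trans (∣-∣-complement-≤ y x y≤x ey ex) (∣-∣-comm y x))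

T-does⇔ : ∀ {P : Set} (P? : Dec P) → T (does P?) ⇔ P
T-does⇔ (yes p) = mk⇔ (λ _ → p) (λ _ → _)
T-does⇔ (no ¬p) = mk⇔ (λ ()) ¬p

indicator : Bool → ℕ
indicator true  = 1
indicator false = 0

length-filter-tabulate : ∀ {m} {A : Set} (f : Fin m → A) (g : A → Bool) →
  length (filter (T? ∘ g) (tabulate f)) ≡ sum (indicator ∘ g ∘ f)
length-filter-tabulate {zero}  f g = refl
length-filter-tabulate {suc m} f g with g (f Fin.zero)
... | true  = cong suc (length-filter-tabulate (f ∘ Fin.suc) g)
... | false = length-filter-tabulate (f ∘ Fin.suc) g

-- For p, z, o < n, rotateℕ p z is z − p and unrotateℕ p o is o + p, both modulo n.
module Rotation (n : ℕ) where

  rotateℕ : ℕ → ℕ → ℕ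
  rotateℕ p z with p ≤? z
  ... | yes _ = z ∸ p
  ... | no  _ = z + (n ∸ p)

  unrotateℕ : ℕ → ℕ → ℕ
  unrotateℕ p o with n ≤? o + p
  ... | yes _ = o + p ∸ n
  ... | no  _ = o + p

  rotateℕ-≥ : ∀ {p z i} → p + i ≡ z → rotateℕ p z ≡ i
  rotateℕ-≥ {p} {z} {i} p+i≡z with p ≤? z
  ... | yes _   = m+n≡o⇒o∸m≡n p+i≡z
  ... | no  p≰z = ⊥-elim (p≰z (subst (p ≤_) p+i≡z (m≤m+n p i)))

  rotateℕ-< : ∀ {p z r} → z < p → p + r ≡ n → rotateℕ p z ≡ z + r
  rotateℕ-< {p} {z} z<p p+r≡n with p ≤? z
  ... | yes p≤z = ⊥-elim (<⇒≱ z<p p≤z)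
  ... | no  _   = cong (z +_) (m+n≡o⇒o∸m≡n p+r≡n)

  unrotateℕ-< : ∀ {p o} → o + p < n → unrotateℕ p o ≡ o + p
  unrotateℕ-< {p} {o} o+p<n with n ≤? o + p
  ... | yes n≤o+p = ⊥-elim (<⇒≱ o+p<n n≤o+p)
  ... | no  _     = refl

  unrotateℕ-≥ : ∀ {p o q} → n + q ≡ o + p → unrotateℕ p o ≡ q
  unrotateℕ-≥ {p} {o} {q} n+q≡o+p with n ≤? o + p
  ... | yes _     = m+n≡o⇒o∸m≡n n+q≡o+p
  ... | no  n≰o+p = ⊥-elim (n≰o+p (subst (n ≤_) n+q≡o+p (m≤m+n n q)))

  rotateℕ<n : ∀ {p z} → p < n → z < n → rotateℕ p z < n
  rotateℕ<n {p} {z} p<n z<n with ≤-<-connex p z | ≤⇒∃ (<⇒≤ p<n)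
  ... | inj₁ p≤z | _ with ≤⇒∃ p≤z
  ...   | i , p+i≡z = subst (_< n) (≡-sym (rotateℕ-≥ {p} p+i≡z))
                        (≤-trans (s≤s (m≤n+m i p)) (subst (_< n) (≡-sym p+i≡z) z<n))
  rotateℕ<n {p} {z} p<n z<n | inj₂ z<p | r , p+r≡n =
    subst (_< n) (≡-sym (rotateℕ-< {p} z<p p+r≡n))
      (≤-by-sum (z<p ⊕ ≤-reflexive p+r≡n) 0 (solve (n ∷ p ∷ z ∷ r ∷ [])))

  unrotateℕ<n : ∀ {p o} → p < n → o < n → unrotateℕ p o < n
  unrotateℕ<n {p} {o} p<n o<n with ≤-<-connex n (o + p)
  ... | inj₂ o+p<n = subst (_< n) (≡-sym (unrotateℕ-< {p} o+p<n)) o+p<n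
  ... | inj₁ n≤o+p with ≤⇒∃ n≤o+p
  ...   | q , n+q≡o+p = subst (_< n) (≡-sym (unrotateℕ-≥ {p} n+q≡o+p))
            (≤-by-sum (o<n ⊕ p<n ⊕ ≤-reflexive n+q≡o+p) 1 (solve (n ∷ p ∷ o ∷ q ∷ [])))

  rotateℕ-unrotateℕ : ∀ {p o} → p < n → o < n → rotateℕ p (unrotateℕ p o) ≡ o
  rotateℕ-unrotateℕ {p} {o} p<n o<n with ≤-<-connex n (o + p)
  ... | inj₂ o+p<n = trans (cong (rotateℕ p) (unrotateℕ-< {p} o+p<n)) (rotateℕ-≥ {p} (+-comm p o))
  ... | inj₁ n≤o+p with ≤⇒∃ n≤o+p | ≤⇒∃ (<⇒≤ p<n)
  ...   | q , n+q≡o+p | r , p+r≡n = begin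
    rotateℕ p (unrotateℕ p o)  ≡⟨ cong (rotateℕ p) (unrotateℕ-≥ {p} n+q≡o+p) ⟩
    rotateℕ p q                ≡⟨ rotateℕ-< {p} q<p p+r≡n ⟩
    q + r                      ≡⟨ +-cancelʳ-≡ p (q + r) o q+r+p≡o+p ⟩
    o                          ∎
    where
    open ≡-Reasoning
    q<p : q < p
    q<p = ≤-by-sum (o<n ⊕ ≤-reflexive n+q≡o+p) 0 (solve (n ∷ p ∷ o ∷ q ∷ []))
    q+r+p≡o+p : q + r + p ≡ o + p
    q+r+p≡o+p = begin
      q + r + p  ≡⟨ solve (q ∷ r ∷ p ∷ []) ⟩
      p + r + q  ≡⟨ cong (_+ q) p+r≡n ⟩
      n + q      ≡⟨ n+q≡o+p ⟩
      o + p      ∎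

  unrotateℕ-rotateℕ : ∀ {p z} → p < n → z < n → unrotateℕ p (rotateℕ p z) ≡ z
  unrotateℕ-rotateℕ {p} {z} p<n z<n with ≤-<-connex p z | ≤⇒∃ (<⇒≤ p<n)
  ... | inj₁ p≤z | _ with ≤⇒∃ p≤z
  ...   | i , p+i≡z = begin
    unrotateℕ p (rotateℕ p z)  ≡⟨ cong (unrotateℕ p) (rotateℕ-≥ {p} p+i≡z) ⟩
    unrotateℕ p i              ≡⟨ unrotateℕ-< {p} (subst (_< n) (≡-sym i+p≡z) z<n) ⟩
    i + p                      ≡⟨ i+p≡z ⟩
    z                          ∎
    where
    open ≡-Reasoning
    i+p≡z : i + p ≡ z
    i+p≡z = trans (+-comm i p) p+i≡z
  unrotateℕ-rotateℕ {p} {z} p<n z<n | inj₂ z<p | r , p+r≡n = begin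
    unrotateℕ p (rotateℕ p z)  ≡⟨ cong (unrotateℕ p) (rotateℕ-< {p} z<p p+r≡n) ⟩
    unrotateℕ p (z + r)        ≡⟨ unrotateℕ-≥ {p} n+z≡z+r+p ⟩
    z                          ∎
    where
    open ≡-Reasoning
    n+z≡z+r+p : n + z ≡ z + r + p
    n+z≡z+r+p = begin
      n + z      ≡⟨ cong (_+ z) p+r≡n ⟨
      p + r + z  ≡⟨ solve (p ∷ r ∷ z ∷ []) ⟩
      z + r + p  ∎

  rotateℕ-self : ∀ p → rotateℕ p p ≡ 0
  rotateℕ-self p = rotateℕ-≥ {p} (+-identityʳ p)

  ∣-∣-rotateℕ-across : ∀ {p z w} → p < n → z < n → p ≤ z → w < p →
                       ∣ z - w ∣ + ∣ rotateℕ p z - rotateℕ p w ∣ ≡ n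
  ∣-∣-rotateℕ-across {p} {z} {w} p<n z<n p≤z w<p
    with ≤⇒∃ p≤z | ≤⇒∃ (<⇒≤ w<p) | ≤⇒∃ (<⇒≤ p<n)
  ... | i , p+i≡z | j , w+j≡p | r , p+r≡n with ≤⇒∃ i≤r
    where
    i≤r : i ≤ r
    i≤r = ≤-by-sum (z<n ⊕ ≤-reflexive (≡-sym p+r≡n) ⊕ ≤-reflexive p+i≡z) 1 (solve (n ∷ p ∷ z ∷ i ∷ r ∷ []))
  ... | s , i+s≡r = begin
    ∣ z - w ∣ + ∣ rotateℕ p z - rotateℕ p w ∣
      ≡⟨ cong₂ (λ a b → ∣ z - w ∣ + ∣ a - b ∣) (rotateℕ-≥ {p} p+i≡z) (rotateℕ-< {p} w<p p+r≡n) ⟩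
    ∣ z - w ∣ + ∣ i - w + r ∣
      ≡⟨ cong₂ _+_ (m+n≡o⇒∣o-m∣≡n w+[j+i]≡z) (m+n≡o⇒∣m-o∣≡n {i} i+[w+s]≡w+r) ⟩
    (j + i) + (w + s)  ≡⟨ solve (j ∷ i ∷ w ∷ s ∷ []) ⟩
    (w + j) + (i + s)  ≡⟨ cong₂ _+_ w+j≡p i+s≡r ⟩
    p + r              ≡⟨ p+r≡n ⟩
    n                  ∎
    where
    open ≡-Reasoning
    w+[j+i]≡z : w + (j + i) ≡ z
    w+[j+i]≡z = trans (≡-sym (+-assoc w j i)) (trans (cong (_+ i) w+j≡p) p+i≡z)
    i+[w+s]≡w+r : i + (w + s) ≡ w + r
    i+[w+s]≡w+r = begin
      i + (w + s)  ≡⟨ solve (i ∷ w ∷ s ∷ []) ⟩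
      w + (i + s)  ≡⟨ cong (w +_) i+s≡r ⟩
      w + r        ∎

  -- Rotation preserves the cyclic distance min(∣z − w∣, n − ∣z − w∣).
  ∣-∣-rotateℕ : ∀ {p z w} → p < n → z < n → w < n →
                ∣ rotateℕ p z - rotateℕ p w ∣ ≡ ∣ z - w ∣ ⊎
                ∣ z - w ∣ + ∣ rotateℕ p z - rotateℕ p w ∣ ≡ n
  ∣-∣-rotateℕ {p} {z} {w} p<n z<n w<n with ≤-<-connex p z | ≤-<-connex p w
  ... | inj₁ p≤z | inj₁ p≤w with ≤⇒∃ p≤z | ≤⇒∃ p≤w
  ...   | i , p+i≡z | j , p+j≡w = inj₁ (begin
    ∣ rotateℕ p z - rotateℕ p w ∣  ≡⟨ cong₂ ∣_-_∣ (rotateℕ-≥ {p} p+i≡z) (rotateℕ-≥ {p} p+j≡w) ⟩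
    ∣ i - j ∣                      ≡⟨ ∣m+n-m+o∣≡∣n-o∣ p i j ⟨
    ∣ p + i - p + j ∣              ≡⟨ cong₂ ∣_-_∣ p+i≡z p+j≡w ⟩
    ∣ z - w ∣                      ∎)
    where open ≡-Reasoning
  ∣-∣-rotateℕ {p} {z} {w} p<n z<n w<n | inj₂ z<p | inj₂ w<p with ≤⇒∃ (<⇒≤ p<n)
  ...   | r , p+r≡n = inj₁ (begin
    ∣ rotateℕ p z - rotateℕ p w ∣  ≡⟨ cong₂ ∣_-_∣ (rotateℕ-< {p} z<p p+r≡n) (rotateℕ-< {p} w<p p+r≡n) ⟩
    ∣ z + r - w + r ∣              ≡⟨ cong₂ ∣_-_∣ (+-comm z r) (+-comm w r) ⟩
    ∣ r + z - r + w ∣              ≡⟨ ∣m+n-m+o∣≡∣n-o∣ r z w ⟩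
    ∣ z - w ∣                      ∎)
    where open ≡-Reasoning
  ∣-∣-rotateℕ {p} {z} {w} p<n z<n w<n | inj₁ p≤z | inj₂ w<p =
    inj₂ (∣-∣-rotateℕ-across p<n z<n p≤z w<p)
  ∣-∣-rotateℕ {p} {z} {w} p<n z<n w<n | inj₂ z<p | inj₁ p≤w =
    inj₂ (subst₂ (λ a b → a + b ≡ n) (∣-∣-comm w z) (∣-∣-comm (rotateℕ p w) (rotateℕ p z))
                 (∣-∣-rotateℕ-across p<n w<n p≤w z<p))

  rotate : Fin n → Fin n → Fin n
  rotate p z = fromℕ< (rotateℕ<n (toℕ<n p) (toℕ<n z))

  unrotate : Fin n → Fin n → Fin n
  unrotate p o = fromℕ< (unrotateℕ<n (toℕ<n p) (toℕ<n o))

  toℕ-rotate : ∀ p z → toℕ (rotate p z) ≡ rotateℕ (toℕ p) (toℕ z)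
  toℕ-rotate p z = toℕ-fromℕ< _

  toℕ-unrotate : ∀ p o → toℕ (unrotate p o) ≡ unrotateℕ (toℕ p) (toℕ o)
  toℕ-unrotate p o = toℕ-fromℕ< _

  toℕ-rotate-self : ∀ p → toℕ (rotate p p) ≡ 0
  toℕ-rotate-self p = trans (toℕ-rotate p p) (rotateℕ-self (toℕ p))

  rotate-unrotate : ∀ p o → rotate p (unrotate p o) ≡ o
  rotate-unrotate p o = toℕ-injective (begin
    toℕ (rotate p (unrotate p o))              ≡⟨ toℕ-rotate p (unrotate p o) ⟩
    rotateℕ (toℕ p) (toℕ (unrotate p o))       ≡⟨ cong (rotateℕ (toℕ p)) (toℕ-unrotate p o) ⟩
    rotateℕ (toℕ p) (unrotateℕ (toℕ p) (toℕ o)) ≡⟨ rotateℕ-unrotateℕ (toℕ<n p) (toℕ<n o) ⟩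
    toℕ o                                       ∎)
    where open ≡-Reasoning

  unrotate-rotate : ∀ p z → unrotate p (rotate p z) ≡ z
  unrotate-rotate p z = toℕ-injective (begin
    toℕ (unrotate p (rotate p z))              ≡⟨ toℕ-unrotate p (rotate p z) ⟩
    unrotateℕ (toℕ p) (toℕ (rotate p z))       ≡⟨ cong (unrotateℕ (toℕ p)) (toℕ-rotate p z) ⟩
    unrotateℕ (toℕ p) (rotateℕ (toℕ p) (toℕ z)) ≡⟨ unrotateℕ-rotateℕ (toℕ<n p) (toℕ<n z) ⟩
    toℕ z                                       ∎)
    where open ≡-Reasoning

  rotation : Fin n → Permutation n n
  rotation p = permutation (unrotate p) (rotate p) (unrotate-rotate p) (rotate-unrotate p)

-- The circulant graph on ℤ_n with connection set S. Since S is closed under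
-- t ↦ n − t, membership of u − v mod n in S can be tested on ∣ u − v ∣.
module Circulant (n : ℕ) {S : ℕ → Set} (S? : Decidable S) (¬S0 : ¬ S 0)
                 (S-reflect : ∀ {t s} → t + s ≡ n → S t → S s) where

  open Rotation n

  circulant : Graph n
  circulant = record
    { adj    = λ u v → does (S? ∣ toℕ u - toℕ v ∣)
    ; sym    = λ u v → cong (does ∘ S?) (∣-∣-comm (toℕ u) (toℕ v))
    ; irrefl = λ v → trans (cong (does ∘ S?) (∣n-n∣≡0 (toℕ v))) (dec-false (S? 0) ¬S0)
    }

  Adj⇔S : ∀ u v → Adj circulant u v ⇔ S ∣ toℕ u - toℕ v ∣
  Adj⇔S u v = T-does⇔ (S? ∣ toℕ u - toℕ v ∣)

  Adj⇒≢ : ∀ {u v} → Adj circulant u v → u ≢ v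
  Adj⇒≢ {u} Auu refl = subst T (irrefl circulant u) Auu

  S-rotateℕ⇔ : ∀ {p z w} → p < n → z < n → w < n → S ∣ z - w ∣ ⇔ S ∣ rotateℕ p z - rotateℕ p w ∣
  S-rotateℕ⇔ {p} {z} {w} p<n z<n w<n with ∣-∣-rotateℕ p<n z<n w<n
  ... | inj₁ eq = mk⇔ (subst S (≡-sym eq)) (subst S eq)
  ... | inj₂ eq = mk⇔ (S-reflect eq) (S-reflect (trans (+-comm _ ∣ z - w ∣) eq))

  S-rotate⇔ : ∀ p z w → S ∣ toℕ z - toℕ w ∣ ⇔ S ∣ toℕ (rotate p z) - toℕ (rotate p w) ∣
  S-rotate⇔ p z w rewrite toℕ-rotate p z | toℕ-rotate p w =
    S-rotateℕ⇔ (toℕ<n p) (toℕ<n z) (toℕ<n w)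

  S-rotate-self⇔ : ∀ p w → S ∣ toℕ p - toℕ w ∣ ⇔ S (toℕ (rotate p w))
  S-rotate-self⇔ p w = subst (λ k → S ∣ toℕ p - toℕ w ∣ ⇔ S ∣ k - toℕ (rotate p w) ∣)
                             (toℕ-rotate-self p) (S-rotate⇔ p p w)

  circulant-regular : Regular circulant
  circulant-regular = sum S-indicator , λ v → begin
    degree circulant v                              ≡⟨ length-filter-tabulate (λ u → u) (adj circulant v) ⟩
    sum (indicator ∘ adj circulant v)               ≡⟨ sum-permute _ (rotation v) ⟩
    sum (indicator ∘ adj circulant v ∘ unrotate v)
      ≡⟨ sum-cong-≗ {y = S-indicator} (cong indicator ∘ adj-unrotate v) ⟩
    sum S-indicator                                 ∎
    where
    open ≡-Reasoning
    S-indicator : Fin n → ℕ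
    S-indicator o = indicator (does (S? (toℕ o)))
    adj-unrotate : ∀ v o → adj circulant v (unrotate v o) ≡ does (S? (toℕ o))
    adj-unrotate v o = does-⇔
      (subst (λ k → S ∣ toℕ v - toℕ (unrotate v o) ∣ ⇔ S (toℕ k)) (rotate-unrotate v o)
             (S-rotate-self⇔ v (unrotate v o)))
      (S? _) (S? _)

  -- K4₀ x y z: {0, x, y, z} is a clique of the distance graph of S;
  -- K4₀-completion t x y: {0, t, x, y} becomes one when the edge 0t is added.
  K4₀ : ℕ → ℕ → ℕ → Set
  K4₀ x y z = S x × S y × S z × S ∣ x - y ∣ × S ∣ x - z ∣ × S ∣ y - z ∣

  K4₀-completion : ℕ → ℕ → ℕ → Set
  K4₀-completion t x y = S x × S y × S ∣ x - t ∣ × S ∣ y - t ∣ × S ∣ x - y ∣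

  K4₀-rotate : ∀ {x y z} → K4₀ x y z → K4₀ y z x
  K4₀-rotate {x} {y} {z} (Sx , Sy , Sz , Sxy , Sxz , Syz) =
    Sy , Sz , Sx , Syz , subst S (∣-∣-comm x y) Sxy , subst S (∣-∣-comm x z) Sxz

  module _ (S<n : ∀ {t} → S t → t < n) where

    private
      reflect : ∀ {t} → S t → t + (n ∸ t) ≡ n
      reflect St = m+[n∸m]≡n (<⇒≤ (S<n St))

      S-reflect-∣-∣ : ∀ {x y} → S x → S y → S ∣ x - y ∣ → S ∣ n ∸ x - n ∸ y ∣
      S-reflect-∣-∣ {x} {y} Sx Sy = subst S (≡-sym (∣-∣-complement x y (reflect Sx) (reflect Sy)))

    K4₀-reflect : ∀ {x y z} → K4₀ x y z → K4₀ (n ∸ x) (n ∸ y) (n ∸ z)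
    K4₀-reflect (Sx , Sy , Sz , Sxy , Sxz , Syz) =
      S-reflect (reflect Sx) Sx , S-reflect (reflect Sy) Sy , S-reflect (reflect Sz) Sz ,
      S-reflect-∣-∣ Sx Sy Sxy , S-reflect-∣-∣ Sx Sz Sxz , S-reflect-∣-∣ Sy Sz Syz

    K4₀-completion-reflect : ∀ {t s x y} → t + s ≡ n → K4₀-completion s x y → K4₀-completion t (n ∸ x) (n ∸ y)
    K4₀-completion-reflect {t} {s} {x} {y} t+s≡n (Sx , Sy , Sxs , Sys , Sxy) =
      S-reflect (reflect Sx) Sx , S-reflect (reflect Sy) Sy ,
      subst S (≡-sym (∣-∣-complement x s (reflect Sx) s+t≡n)) Sxs ,
      subst S (≡-sym (∣-∣-complement y s (reflect Sy) s+t≡n)) Sys ,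
      S-reflect-∣-∣ Sx Sy Sxy
      where
      s+t≡n : s + t ≡ n
      s+t≡n = trans (+-comm s t) t+s≡n

  circulant-K4-free : (∀ {x y z} → ¬ K4₀ x y z) → ¬ ContainsK4 (Adj circulant)
  circulant-K4-free no-K4₀ (q₀ , q₁ , q₂ , q₃ , _ , q₀q₁ , q₀q₂ , q₀q₃ , q₁q₂ , q₁q₃ , q₂q₃) =
    no-K4₀ (from-q₀ q₀q₁ , from-q₀ q₀q₂ , from-q₀ q₀q₃ , seen-from-q₀ q₁q₂ , seen-from-q₀ q₁q₃ , seen-from-q₀ q₂q₃)
    where
    seen-from-q₀ : ∀ {u v} → Adj circulant u v → S ∣ toℕ (rotate q₀ u) - toℕ (rotate q₀ v) ∣
    seen-from-q₀ {u} {v} = Equivalence.to (S-rotate⇔ q₀ u v) ∘ Equivalence.to (Adj⇔S u v)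
    from-q₀ : ∀ {v} → Adj circulant q₀ v → S (toℕ (rotate q₀ v))
    from-q₀ {v} = Equivalence.to (S-rotate-self⇔ q₀ v) ∘ Equivalence.to (Adj⇔S q₀ v)

  circulant-saturating : (∀ {t} → S t → t < n) →
                         (∀ {t} → t < n → ¬ S t → ∃₂ (K4₀-completion t)) →
                         ∀ u v → u ≢ v → ¬ Adj circulant u v → ContainsK4 (AdjPlus circulant u v)
  circulant-saturating S<n complete u v u≢v ¬uv with complete (toℕ<n (rotate u v)) ¬S[t]
    where
    ¬S[t] : ¬ S (toℕ (rotate u v))
    ¬S[t] = ¬uv ∘ Equivalence.from (Adj⇔S u v) ∘ Equivalence.from (S-rotate-self⇔ u v)
  ... | x , y , Sx , Sy , Sxt , Syt , Sxy =
    u , v , X , Y , (u≢v , Adj⇒≢ uX , Adj⇒≢ uY , Adj⇒≢ vX , Adj⇒≢ vY , Adj⇒≢ XY) ,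
    (inj₂ (inj₁ (refl , refl)) , inj₁ uX , inj₁ uY , inj₁ vX , inj₁ vY , inj₁ XY)
    where
    lift : ∀ {o} → S o → Fin n
    lift So = unrotate u (fromℕ< (S<n So))
    toℕ-rotate-lift : ∀ {o} (So : S o) → toℕ (rotate u (lift So)) ≡ o
    toℕ-rotate-lift So = trans (cong toℕ (rotate-unrotate u _)) (toℕ-fromℕ< (S<n So))
    adjacent : ∀ {z w a b} → toℕ (rotate u z) ≡ a → toℕ (rotate u w) ≡ b → S ∣ a - b ∣ → Adj circulant z w
    adjacent {z} {w} refl refl = Equivalence.from (Adj⇔S z w) ∘ Equivalence.from (S-rotate⇔ u z w)
    X = lift Sx
    Y = lift Sy
    uX : Adj circulant u X
    uX = adjacent (toℕ-rotate-self u) (toℕ-rotate-lift Sx) Sx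
    uY : Adj circulant u Y
    uY = adjacent (toℕ-rotate-self u) (toℕ-rotate-lift Sy) Sy
    vX : Adj circulant v X
    vX = adjacent refl (toℕ-rotate-lift Sx) (subst S (∣-∣-comm x _) Sxt)
    vY : Adj circulant v Y
    vY = adjacent refl (toℕ-rotate-lift Sy) (subst S (∣-∣-comm y _) Syt)
    XY : Adj circulant X Y
    XY = adjacent (toℕ-rotate-lift Sx) (toℕ-rotate-lift Sy) Sxy

module Construction (n a : ℕ) (8a≤n+2 : 8 * a ≤ n + 2) (n+3≤10a : n + 3 ≤ 10 * a) where

  Low : ℕ → Set
  Low t = a ≤ t × t < 3 * a

  High : ℕ → Set
  High t = a + t ≤ n × n < 3 * a + t

  InA : ℕ → Set
  InA t = Low t ⊎ High t

  InA? : Decidable InA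
  InA? t = ((a ≤? t) ×-dec (t <? 3 * a)) ⊎-dec ((a + t ≤? n) ×-dec (n <? 3 * a + t))

  1≤a : 1 ≤ a
  1≤a = positive a n+3≤10a
    where
    positive : ∀ k → n + 3 ≤ 10 * k → 1 ≤ k
    positive zero    n+3≤0 = ⊥-elim (absurd-by-sum (≤-trans (m≤n+m 3 n) n+3≤0) 2 refl)
    positive (suc _) _     = s≤s z≤n

  5≤5a : 5 ≤ 5 * a
  5≤5a = *-monoʳ-≤ 5 1≤a

  ¬InA0 : ¬ InA 0
  ¬InA0 (inj₁ (a≤0 , _)) = absurd-by-sum (1≤a ⊕ a≤0) 0 (solve (a ∷ []))
  ¬InA0 (inj₂ (_ , n<3a)) = absurd-by-sum (n<3a ⊕ 8a≤n+2 ⊕ 5≤5a) 3 (solve (n ∷ a ∷ []))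

  InA<n : ∀ {t} → InA t → t < n
  InA<n {t} (inj₁ (_ , t<3a)) = ≤-by-sum (t<3a ⊕ 8a≤n+2 ⊕ 5≤5a) 3 (solve (n ∷ a ∷ t ∷ []))
  InA<n {t} (inj₂ (a+t≤n , _)) = ≤-by-sum (a+t≤n ⊕ 1≤a) 0 (solve (n ∷ a ∷ t ∷ []))

  Low-reflect : ∀ {t s} → t + s ≡ n → Low t → High s
  Low-reflect {t} {s} t+s≡n (a≤t , t<3a) =
    ≤-by-sum (a≤t ⊕ ≤-reflexive t+s≡n) 0 (solve (n ∷ a ∷ t ∷ s ∷ [])) ,
    ≤-by-sum (t<3a ⊕ ≤-reflexive (≡-sym t+s≡n)) 0 (solve (n ∷ a ∷ t ∷ s ∷ []))

  High-reflect : ∀ {t s} → t + s ≡ n → High t → Low s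
  High-reflect {t} {s} t+s≡n (a+t≤n , n<3a+t) =
    ≤-by-sum (a+t≤n ⊕ ≤-reflexive (≡-sym t+s≡n)) 0 (solve (n ∷ a ∷ t ∷ s ∷ [])) ,
    ≤-by-sum (n<3a+t ⊕ ≤-reflexive t+s≡n) 0 (solve (n ∷ a ∷ t ∷ s ∷ []))

  InA-reflect : ∀ {t s} → t + s ≡ n → InA t → InA s
  InA-reflect t+s≡n (inj₁ low)  = inj₂ (Low-reflect t+s≡n low)
  InA-reflect t+s≡n (inj₂ high) = inj₁ (High-reflect t+s≡n high)

  open Circulant n InA? ¬InA0 InA-reflect public

  Jump : ℕ → ℕ → Set
  Jump u v = ∃ λ d → u + d ≡ v × a ≤ d

  Low-jump : ∀ {x y} → Low y → InA ∣ x - y ∣ → x ≤ y → Jump x y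
  Low-jump {x} {y} (_ , y<3a) A[x-y] x≤y with ≤⇒∃ x≤y
  ... | d , x+d≡y with subst InA (m+n≡o⇒∣m-o∣≡n x+d≡y) A[x-y]
  ...   | inj₁ (a≤d , _)    = d , x+d≡y , a≤d
  ...   | inj₂ (_ , n<3a+d) = ⊥-elim (absurd-by-sum
          (n<3a+d ⊕ ≤-reflexive x+d≡y ⊕ y<3a ⊕ 8a≤n+2 ⊕ 1≤a) (x + a) (solve (n ∷ a ∷ x ∷ y ∷ d ∷ [])))

  Low-jump-either : ∀ {x y} → Low x → Low y → InA ∣ x - y ∣ → Jump x y ⊎ Jump y x
  Low-jump-either {x} {y} lx ly A[x-y] with ≤-total x y
  ... | inj₁ x≤y = inj₁ (Low-jump ly A[x-y] x≤y)
  ... | inj₂ y≤x = inj₂ (Low-jump lx (subst InA (∣-∣-comm x y) A[x-y]) y≤x)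

  -- Low has width 2a, so it cannot contain two successive jumps.
  no-double-jump : ∀ {x y z} → Low x → Low z → Jump x y → Jump y z → ⊥
  no-double-jump {x} {y} {z} (a≤x , _) (_ , z<3a) (d₁ , x+d₁≡y , a≤d₁) (d₂ , y+d₂≡z , a≤d₂) =
    absurd-by-sum (a≤x ⊕ ≤-reflexive x+d₁≡y ⊕ ≤-reflexive y+d₂≡z ⊕ a≤d₁ ⊕ a≤d₂ ⊕ z<3a) 0
                  (solve (a ∷ x ∷ y ∷ z ∷ d₁ ∷ d₂ ∷ []))

  no-K4₀-LowLowLow : ∀ {x y z} → Low x → Low y → Low z → InA ∣ x - y ∣ → InA ∣ x - z ∣ → InA ∣ y - z ∣ → ⊥
  no-K4₀-LowLowLow lx ly lz A[x-y] A[x-z] A[y-z]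
    with Low-jump-either lx ly A[x-y] | Low-jump-either ly lz A[y-z] | Low-jump-either lx lz A[x-z]
  ... | inj₁ x↑y | inj₁ y↑z | _        = no-double-jump lx lz x↑y y↑z
  ... | inj₁ x↑y | inj₂ z↑y | inj₁ x↑z = no-double-jump lx ly x↑z z↑y
  ... | inj₁ x↑y | inj₂ z↑y | inj₂ z↑x = no-double-jump lz ly z↑x x↑y
  ... | inj₂ y↑x | inj₁ y↑z | inj₁ x↑z = no-double-jump ly lz y↑x x↑z
  ... | inj₂ y↑x | inj₁ y↑z | inj₂ z↑x = no-double-jump ly lx y↑z z↑x
  ... | inj₂ y↑x | inj₂ z↑y | _        = no-double-jump lz lx z↑y y↑x

  Low≤High : ∀ {x z} → Low x → High z → x ≤ z
  Low≤High {x} {z} (_ , x<3a) (_ , n<3a+z) =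
    ≤-by-sum (x<3a ⊕ n<3a+z ⊕ 8a≤n+2 ⊕ 1≤a ⊕ 1≤a) 2 (solve (n ∷ a ∷ x ∷ z ∷ []))

  Jump-below-High-absurd : ∀ {x y z e₁ e₂} → a ≤ x → Jump x y → y < 3 * a → High z →
                     x + e₁ ≡ z → y + e₂ ≡ z → InA e₁ → InA e₂ → ⊥
  Jump-below-High-absurd {x} {y} {z} {e₁} {e₂} _ (d , x+d≡y , a≤d) y<3a (_ , n<3a+z) x+e₁≡z _ (inj₁ (_ , e₁<3a)) _ =
    absurd-by-sum (e₁<3a ⊕ ≤-reflexive (≡-sym x+e₁≡z) ⊕ ≤-reflexive x+d≡y ⊕ a≤d ⊕ y<3a ⊕ n<3a+z ⊕ 8a≤n+2) 0
                  (solve (n ∷ a ∷ x ∷ y ∷ z ∷ d ∷ e₁ ∷ []))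
  Jump-below-High-absurd {x} {y} {z} {e₁} {e₂} a≤x _ y<3a _ x+e₁≡z y+e₂≡z (inj₂ (_ , n<3a+e₁)) (inj₁ (_ , e₂<3a)) =
    absurd-by-sum (n<3a+e₁ ⊕ ≤-reflexive x+e₁≡z ⊕ ≤-reflexive (≡-sym y+e₂≡z) ⊕ e₂<3a ⊕ y<3a ⊕ a≤x ⊕ 8a≤n+2) 0
                  (solve (n ∷ a ∷ x ∷ y ∷ z ∷ e₁ ∷ e₂ ∷ []))
  Jump-below-High-absurd {x} {y} {z} {e₁} {e₂} a≤x (d , x+d≡y , a≤d) _ (a+z≤n , _) _ y+e₂≡z
                         (inj₂ _) (inj₂ (_ , n<3a+e₂)) =
    absurd-by-sum (n<3a+e₂ ⊕ ≤-reflexive y+e₂≡z ⊕ a+z≤n ⊕ a≤x ⊕ a≤d ⊕ ≤-reflexive x+d≡y) 0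
                  (solve (n ∷ a ∷ x ∷ y ∷ z ∷ d ∷ e₂ ∷ []))

  no-K4₀-Jump-High : ∀ {x y z} → Low x → Low y → High z → Jump x y → InA ∣ x - z ∣ → InA ∣ y - z ∣ → ⊥
  no-K4₀-Jump-High lx@(a≤x , _) ly@(_ , y<3a) hz x↑y A[x-z] A[y-z]
    with ≤⇒∃ (Low≤High lx hz) | ≤⇒∃ (Low≤High ly hz)
  ... | e₁ , x+e₁≡z | e₂ , y+e₂≡z =
    Jump-below-High-absurd a≤x x↑y y<3a hz x+e₁≡z y+e₂≡z
      (subst InA (m+n≡o⇒∣m-o∣≡n x+e₁≡z) A[x-z]) (subst InA (m+n≡o⇒∣m-o∣≡n y+e₂≡z) A[y-z])

  no-K4₀-LowLowHigh : ∀ {x y z} → Low x → Low y → High z → InA ∣ x - y ∣ → InA ∣ x - z ∣ → InA ∣ y - z ∣ → ⊥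
  no-K4₀-LowLowHigh lx ly hz A[x-y] A[x-z] A[y-z] with Low-jump-either lx ly A[x-y]
  ... | inj₁ x↑y = no-K4₀-Jump-High lx ly hz x↑y A[x-z] A[y-z]
  ... | inj₂ y↑x = no-K4₀-Jump-High ly lx hz y↑x A[y-z] A[x-z]

  no-K4₀-Low : ∀ {x y z} → Low x → Low y → ¬ K4₀ x y z
  no-K4₀-Low lx ly (_ , _ , inj₁ lz , A[x-y] , A[x-z] , A[y-z]) = no-K4₀-LowLowLow lx ly lz A[x-y] A[x-z] A[y-z]
  no-K4₀-Low lx ly (_ , _ , inj₂ hz , A[x-y] , A[x-z] , A[y-z]) = no-K4₀-LowLowHigh lx ly hz A[x-y] A[x-z] A[y-z]

  High⇒Low-complement : ∀ {t} → High t → Low (n ∸ t)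
  High⇒Low-complement h = High-reflect (m+[n∸m]≡n (<⇒≤ (InA<n (inj₂ h)))) h

  -- Two of x, y, z lie in the same half of A, and t ↦ n − t swaps the halves.
  no-K4₀ : ∀ {x y z} → ¬ K4₀ x y z
  no-K4₀ k@(inj₁ lx , inj₁ ly , _ , _)       = no-K4₀-Low lx ly k
  no-K4₀ k@(inj₁ lx , inj₂ _ , inj₁ lz , _)  = no-K4₀-Low lz lx (K4₀-rotate (K4₀-rotate k))
  no-K4₀ k@(inj₂ _ , inj₁ ly , inj₁ lz , _)  = no-K4₀-Low ly lz (K4₀-rotate k)
  no-K4₀ k@(inj₂ hx , inj₂ hy , _ , _)       =
    no-K4₀-Low (High⇒Low-complement hx) (High⇒Low-complement hy) (K4₀-reflect InA<n k)
  no-K4₀ k@(inj₂ hx , inj₁ _ , inj₂ hz , _)  =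
    no-K4₀-Low (High⇒Low-complement hz) (High⇒Low-complement hx) (K4₀-reflect InA<n (K4₀-rotate (K4₀-rotate k)))
  no-K4₀ k@(inj₁ _ , inj₂ hy , inj₂ hz , _)  =
    no-K4₀-Low (High⇒Low-complement hy) (High⇒Low-complement hz) (K4₀-reflect InA<n (K4₀-rotate k))

  Low-a : Low a
  Low-a = ≤-refl , ≤-by-sum (1≤a ⊕ 1≤a) 1 (solve (a ∷ []))

  Low-2a : Low (a + a)
  Low-2a = m≤m+n a a , ≤-by-sum 1≤a 0 (solve (a ∷ []))

  InA-∣-∣ : ∀ {x d y} → x + d ≡ y → InA d → InA ∣ x - y ∣
  InA-∣-∣ x+d≡y = subst InA (≡-sym (m+n≡o⇒∣m-o∣≡n x+d≡y))

  InA-∣-∣′ : ∀ {x d y} → x + d ≡ y → InA d → InA ∣ y - x ∣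
  InA-∣-∣′ x+d≡y = subst InA (≡-sym (m+n≡o⇒∣o-m∣≡n x+d≡y))

  completion-below-a : ∀ {t} → t < a → K4₀-completion t (t + a) (t + a + a)
  completion-below-a {t} t<a =
    inj₁ (m≤n+m a t , ≤-by-sum t<a a (solve (a ∷ t ∷ []))) ,
    inj₁ (≤-trans (m≤n+m a t) (m≤m+n (t + a) a) , ≤-by-sum t<a 0 (solve (a ∷ t ∷ []))) ,
    InA-∣-∣′ {t} refl (inj₁ Low-a) ,
    InA-∣-∣′ {t} (≡-sym (+-assoc t a a)) (inj₁ Low-2a) ,
    InA-∣-∣ {t + a} refl (inj₁ Low-a)

  completion-above-n-a : ∀ {t} → t < n → n < a + t → K4₀-completion t a (a + a)
  completion-above-n-a {t} t<n n<a+t with ≤⇒∃ a≤t | ≤⇒∃ 2a≤t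
    where
    a≤t : a ≤ t
    a≤t = ≤-by-sum (n<a+t ⊕ 8a≤n+2 ⊕ 1≤a) (a + a + a + a + a) (solve (n ∷ a ∷ t ∷ []))
    2a≤t : a + a ≤ t
    2a≤t = ≤-by-sum (n<a+t ⊕ 8a≤n+2 ⊕ 1≤a) (a + a + a + a) (solve (n ∷ a ∷ t ∷ []))
  ... | d₁ , a+d₁≡t | d₂ , 2a+d₂≡t =
    inj₁ Low-a , inj₁ Low-2a ,
    InA-∣-∣ {a} a+d₁≡t (inj₂ (≤-trans (≤-reflexive a+d₁≡t) (<⇒≤ t<n) ,
      ≤-by-sum (n<a+t ⊕ ≤-reflexive (≡-sym a+d₁≡t)) a (solve (n ∷ a ∷ t ∷ d₁ ∷ [])))) ,
    InA-∣-∣ {a + a} 2a+d₂≡t (inj₂ (≤-by-sum (≤-reflexive 2a+d₂≡t ⊕ t<n) (suc a) (solve (n ∷ a ∷ t ∷ d₂ ∷ [])) ,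
      ≤-by-sum (n<a+t ⊕ ≤-reflexive (≡-sym 2a+d₂≡t)) 0 (solve (n ∷ a ∷ t ∷ d₂ ∷ [])))) ,
    InA-∣-∣ {a} refl (inj₁ Low-a)

  completion-middle-low : ∀ {t} → 3 * a ≤ t → t < 4 * a → K4₀-completion t a (a + a)
  completion-middle-low {t} 3a≤t t<4a with ≤⇒∃ (≤-trans (m≤m+n a (2 * a)) 3a≤t) | ≤⇒∃ (≤-trans 2a≤3a 3a≤t)
    where
    2a≤3a : a + a ≤ 3 * a
    2a≤3a = ≤-by-sum (z≤n {a}) 0 (solve (a ∷ []))
  ... | d₁ , a+d₁≡t | d₂ , 2a+d₂≡t =
    inj₁ Low-a , inj₁ Low-2a ,
    InA-∣-∣ {a} a+d₁≡t (inj₁ (≤-by-sum (3a≤t ⊕ ≤-reflexive (≡-sym a+d₁≡t)) a (solve (a ∷ t ∷ d₁ ∷ [])) ,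
                              ≤-by-sum (t<4a ⊕ ≤-reflexive a+d₁≡t) 0 (solve (a ∷ t ∷ d₁ ∷ [])))) ,
    InA-∣-∣ {a + a} 2a+d₂≡t (inj₁ (≤-by-sum (3a≤t ⊕ ≤-reflexive (≡-sym 2a+d₂≡t)) 0 (solve (a ∷ t ∷ d₂ ∷ [])) ,
                                  ≤-by-sum (t<4a ⊕ ≤-reflexive 2a+d₂≡t) a (solve (a ∷ t ∷ d₂ ∷ [])))) ,
    InA-∣-∣ {a} refl (inj₁ Low-a)

  completion-middle-high : ∀ {t k} → 4 * a ≤ t → suc t < 5 * a → 3 * a + k ≡ suc t → K4₀-completion t k (k + a)
  completion-middle-high {t} {k} 4a≤t t+1<5a 3a+k≡t+1 with ≤⇒∃ k≤t | ≤⇒∃ k+a≤t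
    where
    k≤t : k ≤ t
    k≤t = ≤-by-sum (≤-reflexive 3a+k≡t+1 ⊕ 1≤a) (a + a) (solve (a ∷ t ∷ k ∷ []))
    k+a≤t : k + a ≤ t
    k+a≤t = ≤-by-sum (≤-reflexive 3a+k≡t+1 ⊕ 1≤a) a (solve (a ∷ t ∷ k ∷ []))
  ... | d₁ , k+d₁≡t | d₂ , k+a+d₂≡t =
    inj₁ (≤-by-sum (4a≤t ⊕ ≤-reflexive (≡-sym 3a+k≡t+1)) 1 (solve (a ∷ t ∷ k ∷ [])) ,
          ≤-by-sum (t+1<5a ⊕ ≤-reflexive 3a+k≡t+1) a (solve (a ∷ t ∷ k ∷ []))) ,
    inj₁ (m≤n+m a k , ≤-by-sum (t+1<5a ⊕ ≤-reflexive 3a+k≡t+1) 0 (solve (a ∷ t ∷ k ∷ []))) ,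
    InA-∣-∣ {k} k+d₁≡t
      (inj₁ (≤-by-sum (≤-reflexive (≡-sym k+d₁≡t) ⊕ ≤-reflexive 3a+k≡t+1 ⊕ 1≤a) a (solve (a ∷ t ∷ k ∷ d₁ ∷ [])) ,
             ≤-by-sum (≤-reflexive k+d₁≡t ⊕ ≤-reflexive (≡-sym 3a+k≡t+1)) 0 (solve (a ∷ t ∷ k ∷ d₁ ∷ [])))) ,
    InA-∣-∣ {k + a} k+a+d₂≡t
      (inj₁ (≤-by-sum (≤-reflexive (≡-sym k+a+d₂≡t) ⊕ ≤-reflexive 3a+k≡t+1 ⊕ 1≤a) 0 (solve (a ∷ t ∷ k ∷ d₂ ∷ [])) ,
             ≤-by-sum (≤-reflexive k+a+d₂≡t ⊕ ≤-reflexive (≡-sym 3a+k≡t+1)) a (solve (a ∷ t ∷ k ∷ d₂ ∷ [])))) ,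
    InA-∣-∣ {k} refl (inj₁ Low-a)

  completion-middle : ∀ {t} → 3 * a ≤ t → suc t < 5 * a → ∃₂ (K4₀-completion t)
  completion-middle {t} 3a≤t t+1<5a with t <? 4 * a
  ... | yes t<4a = _ , _ , completion-middle-low 3a≤t t<4a
  ... | no  t≮4a = _ , _ , completion-middle-high (≮⇒≥ t≮4a) t+1<5a (m+[n∸m]≡n (≤-trans 3a≤t (n≤1+n t)))

  completion-middle-reflected : ∀ {t} → 3 * a + t ≤ n → 5 * a ≤ suc t → ∃₂ (K4₀-completion t)
  completion-middle-reflected {t} 3a+t≤n 5a≤t+1 with ≤⇒∃ (≤-trans (m≤n+m t (3 * a)) 3a+t≤n)
  ... | s , t+s≡n with completion-middle 3a≤s s+1<5a
    where
    3a≤s : 3 * a ≤ s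
    3a≤s = ≤-by-sum (3a+t≤n ⊕ ≤-reflexive (≡-sym t+s≡n)) 0 (solve (n ∷ a ∷ t ∷ s ∷ []))
    s+1<5a : suc s < 5 * a
    s+1<5a = ≤-by-sum (n+3≤10a ⊕ 5a≤t+1 ⊕ ≤-reflexive t+s≡n) 0 (solve (n ∷ a ∷ t ∷ s ∷ []))
  ...   | x , y , x,y-complete = n ∸ x , n ∸ y , K4₀-completion-reflect InA<n t+s≡n x,y-complete

  completion : ∀ {t} → t < n → ¬ InA t → ∃₂ (K4₀-completion t)
  completion {t} t<n ¬At with a ≤? t
  ... | no a≰t = _ , _ , completion-below-a (≰⇒> a≰t)
  ... | yes a≤t with t <? 3 * a
  ...   | yes t<3a = ⊥-elim (¬At (inj₁ (a≤t , t<3a)))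
  ...   | no  t≮3a with a + t ≤? n
  ...     | no  a+t≰n = _ , _ , completion-above-n-a t<n (≰⇒> a+t≰n)
  ...     | yes a+t≤n with n <? 3 * a + t
  ...       | yes n<3a+t = ⊥-elim (¬At (inj₂ (a+t≤n , n<3a+t)))
  ...       | no  n≮3a+t with suc t <? 5 * a
  ...         | yes t+1<5a = completion-middle (≮⇒≥ t≮3a) t+1<5a
  ...         | no  t+1≮5a = completion-middle-reflected (≮⇒≥ n≮3a+t) (≮⇒≥ t+1≮5a)

-- Take a = ⌊(n + 2)/8⌋: the bound n + 3 ≤ 10a reduces to a ≥ 4, which 8a ≥ n − 5 ≥ 31 forces.
construction-parameters : ∀ n → n ≥ 36 → ∃ λ a → 8 * a ≤ n + 2 × n + 3 ≤ 10 * a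
construction-parameters n n≥36 =
  from-division ((n + 2) / 8) ((n + 2) % 8) (m≡m%n+[m/n]*n (n + 2) 8) (m%n<n (n + 2) 8)
  where
  from-division : ∀ q r → n + 2 ≡ r + q * 8 → r < 8 → ∃ λ a → 8 * a ≤ n + 2 × n + 3 ≤ 10 * a
  from-division q r n+2≡r+8q r<8 with 4 ≤? q
  ... | no  4≰q = ⊥-elim (absurd-by-sum
        (n≥36 ⊕ ≤-reflexive n+2≡r+8q ⊕ r<8 ⊕ 8q≤24) 6 (solve (n ∷ q ∷ r ∷ [])))
    where
    8q≤24 : 8 * q ≤ 24
    8q≤24 = *-monoʳ-≤ 8 (≤-pred (≰⇒> 4≰q))
  ... | yes 4≤q = q ,
        ≤-by-sum (≤-reflexive (≡-sym n+2≡r+8q)) r (solve (n ∷ q ∷ r ∷ [])) ,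
        ≤-by-sum (≤-reflexive n+2≡r+8q ⊕ r<8 ⊕ 4≤q ⊕ 4≤q) 0 (solve (n ∷ q ∷ r ∷ []))

theorem3p4 : ∀ (n : ℕ) → n ≥ 36 → Σ (Graph n) λ G → Regular G × K4Saturated G
theorem3p4 n n≥36 with construction-parameters n n≥36
... | a , 8a≤n+2 , n+3≤10a =
  circulant , circulant-regular , circulant-K4-free no-K4₀ , circulant-saturating InA<n completion
  where open Construction n a 8a≤n+2 n+3≤10a
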